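{- Let ${\cal D}=(V,{\cal B})$ be a packing {\rm PD}$(v,k,1)$, let $\beta=\{B_1,\dots,B_t\}\subset{\cal B}$ be a set of $t$ blocks, and let ${\cal D}\setminus\beta=(V,{\cal B}\setminus\beta)$ be the design obtained by removing these blocks. Then \[\chi({\cal D})-\left\lceil\frac{t}{k-1}\right\rceil\le\chi({\cal D}\setminus\beta)\le\chi({\cal D}).\]
   Context: A packing design {\rm PD}$(v,k,1)$ is a pair $(V,{\cal B})$ with $|V|=v$ and ${\cal B}$ a collection of $k$-subsets (blocks) of $V$ such that every pair of points lies in at most one block. A weak $c$-colouring of a design is a map from its points to $c$ colours such that no block is monochromatic; the chromatic number $\chi$ is the least $c$ admitting a weak $c$-colouring. -}

module Defs where

open import Data.Nat using (ℕ; zero; suc; _+_; _<_)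
open import Data.Nat.DivMod using (_/_)
open import Data.Fin using (Fin)
open import Data.Fin.Subset using (Subset; _∈_; ∣_∣)
open import Data.List using (List; length; lookup)
open import Data.List.Membership.Propositional using () renaming (_∈_ to _∈ₗ_)
open import Data.Product using (Σ; _×_)
open import Relation.Nullary using (¬_)
open import Relation.Binary.PropositionalEquality using (_≡_; _≢_)

-- Ceiling division ⌈ t / d ⌉ (junk value 0 when d = 0).
⌈_/_⌉ : ℕ → ℕ → ℕ
⌈ t / zero ⌉ = 0
⌈ t / suc m ⌉ = (t + m) / suc m

-- A design on point set Fin v: a list of blocks, each a subset of the points.
-- The packing condition forbids repeated blocks (for k ≥ 2), so the list is a set.
IsPacking : (v k : ℕ) → List (Subset v) → Set
IsPacking v k ℬ =
  (∀ (i : Fin (length ℬ)) → ∣ lookup ℬ i ∣ ≡ k) ×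
  (∀ (i j : Fin (length ℬ)) (x y : Fin v) → x ≢ y →
     x ∈ lookup ℬ i → y ∈ lookup ℬ i → x ∈ lookup ℬ j → y ∈ lookup ℬ j → i ≡ j)

Monochromatic : {v c : ℕ} → (Fin v → Fin c) → Subset v → Set
Monochromatic {v} f B = ∀ (x y : Fin v) → x ∈ B → y ∈ B → f x ≡ f y

IsWeakColouring : {v : ℕ} (c : ℕ) → List (Subset v) → (Fin v → Fin c) → Set
IsWeakColouring c ℬ f = ∀ B → B ∈ₗ ℬ → ¬ Monochromatic f B

WeakColourable : {v : ℕ} → List (Subset v) → ℕ → Set
WeakColourable ℬ c = Σ (_ → Fin c) (IsWeakColouring c ℬ)

IsChromaticNumber : {v : ℕ} → List (Subset v) → ℕ → Set
IsChromaticNumber ℬ χ = WeakColourable ℬ χ × (∀ c → c < χ → ¬ WeakColourable ℬ c)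

-- Every block has k points, so any k − 1 β++ℬ'⊆ℬ can be made non-monochromatic by choosing one
-- point in each and giving the chosen points, at most k − 1 of them, a fresh colour: a block
-- monochromatic in the new colouring and meeting the chosen points would lie among them.
-- Splitting the t removed β++ℬ'⊆ℬ into ⌈t/(k−1)⌉ batches of at most k − 1 β++ℬ'⊆ℬ thus turns a
-- weak colouring of D∖β into one of D with ⌈t/(k−1)⌉ more colours.
module Submission where

open import Defs
open import Data.Nat using (ℕ; _+_; _≤_; _∸_)
open import Data.Product using (_×_)
open import Relation.Binary.PropositionalEquality using (_≡_)
open import Data.Fin.Subset using (Subset)
open import Data.List using (List; length; _++_)
open import Data.List.Relation.Binary.Permutation.Propositional using (_↭_)

open import Function using (_∘_)
open import Data.Nat using (zero; suc; _*_; _<_; z≤n; s≤s; z<s; _%_)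
open import Data.Nat.Properties
open import Data.Nat.DivMod using (m≡m%n+[m/n]*n; m%n<n)
open import Data.Fin using (Fin; fromℕ; inject₁)
open import Data.Fin.Properties using (fromℕ≢inject₁; inject₁-injective)
open import Data.Fin.Subset using (_∈_; _∉_; _⊆_; _∩_; _∪_; ⁅_⁆; ∣_∣; ⊥; Nonempty; inside; outside)
open import Data.Fin.Subset.Properties
  using (_∈?_; nonempty?; Empty-unique; ∣⊥∣≡0; ∣⁅x⁆∣≡1; ∣p∣≤∣x∷p∣; p⊆q⇒∣p∣≤∣q∣; x∈⁅x⁆; x∈p∩q⁺; x∈p∩q⁻; x∈p∪q⁺)
open import Data.Vec using (_∷_; [])
open import Data.List using ([]; _∷_; take; drop)
open import Data.List.Properties using (length-take; length-drop; take++drop≡id; ++-assoc)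
open import Data.List.Membership.Propositional using () renaming (_∈_ to _∈ₗ_)
open import Data.List.Membership.Propositional.Properties using (∈-++⁺ʳ; ∈-++⁻)
open import Data.List.Relation.Unary.All using (All; []; _∷_)
import Data.List.Relation.Unary.All as All
import Data.List.Relation.Unary.All.Properties as All
open import Data.List.Relation.Unary.Any using (index)
open import Data.List.Relation.Unary.Any.Properties using (lookup-index)
open import Data.List.Relation.Binary.Permutation.Propositional using (↭-sym)
open import Data.List.Relation.Binary.Permutation.Propositional.Properties using (∈-resp-↭)
open import Data.Product using (∃-syntax; _,_; proj₁; proj₂)
open import Data.Sum using (inj₁; inj₂)
open import Relation.Nullary using (yes; no; contradiction)
open import Relation.Binary.PropositionalEquality using (refl; sym; trans; cong; subst; module ≡-Reasoning)

∣p∪q∣≤∣p∣+∣q∣ : ∀ {n} (p q : Subset n) → ∣ p ∪ q ∣ ≤ ∣ p ∣ + ∣ q ∣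
∣p∪q∣≤∣p∣+∣q∣ []            []            = z≤n
∣p∪q∣≤∣p∣+∣q∣ (inside  ∷ p) (x       ∷ q) =
  s≤s (≤-trans (∣p∪q∣≤∣p∣+∣q∣ p q) (+-monoʳ-≤ ∣ p ∣ (∣p∣≤∣x∷p∣ x q)))
∣p∪q∣≤∣p∣+∣q∣ (outside ∷ p) (inside  ∷ q) =
  ≤-trans (s≤s (∣p∪q∣≤∣p∣+∣q∣ p q)) (≤-reflexive (sym (+-suc ∣ p ∣ ∣ q ∣)))
∣p∪q∣≤∣p∣+∣q∣ (outside ∷ p) (outside ∷ q) = ∣p∪q∣≤∣p∣+∣q∣ p q

0<∣p∣⇒Nonempty : ∀ {n} (p : Subset n) → 0 < ∣ p ∣ → Nonempty p
0<∣p∣⇒Nonempty {n} p 0<∣p∣ with nonempty? p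
... | yes p≠∅ = p≠∅
... | no  p=∅ = contradiction (trans (cong ∣_∣ (Empty-unique p=∅)) (∣⊥∣≡0 n)) (>⇒≢ 0<∣p∣)

transversal : ∀ {n} (γ : List (Subset n)) → All Nonempty γ →
              ∃[ P ] ∣ P ∣ ≤ length γ × All (λ B → Nonempty (B ∩ P)) γ
transversal {n} []      []                = ⊥ , ≤-reflexive (∣⊥∣≡0 n) , []
transversal (B ∷ γ) ((x , x∈B) ∷ γ≠∅) =
  let P , ∣P∣≤∣γ∣ , hits = transversal γ γ≠∅
      widen : ∀ {C} → Nonempty (C ∩ P) → Nonempty (C ∩ (⁅ x ⁆ ∪ P))
      widen {C} (y , y∈C∩P) = let y∈C , y∈P = x∈p∩q⁻ C P y∈C∩P
                              in  y , x∈p∩q⁺ (y∈C , x∈p∪q⁺ (inj₂ y∈P))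
  in  ⁅ x ⁆ ∪ P
    , (begin
        ∣ ⁅ x ⁆ ∪ P ∣       ≤⟨ ∣p∪q∣≤∣p∣+∣q∣ ⁅ x ⁆ P ⟩
        ∣ ⁅ x ⁆ ∣ + ∣ P ∣   ≡⟨ cong (_+ ∣ P ∣) (∣⁅x⁆∣≡1 x) ⟩
        suc ∣ P ∣           ≤⟨ s≤s ∣P∣≤∣γ∣ ⟩
        suc (length γ)      ∎)
    , (x , x∈p∩q⁺ (x∈B , x∈p∪q⁺ (inj₁ (x∈⁅x⁆ x)))) ∷ All.map widen hits
  where open ≤-Reasoning

module _ {v c : ℕ} (P : Subset v) (f : Fin v → Fin c) where

  recolour : Fin v → Fin (suc c)
  recolour x with x ∈? P
  ... | yes _ = fromℕ c
  ... | no  _ = inject₁ (f x)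

  recolour-∈ : ∀ {x} → x ∈ P → recolour x ≡ fromℕ c
  recolour-∈ {x} x∈P with x ∈? P
  ... | yes _   = refl
  ... | no  x∉P = contradiction x∈P x∉P

  recolour-∉ : ∀ {x} → x ∉ P → recolour x ≡ inject₁ (f x)
  recolour-∉ {x} x∉P with x ∈? P
  ... | yes x∈P = contradiction x∈P x∉P
  ... | no  _   = refl

  recolour≡fromℕ⇒∈ : ∀ {x} → recolour x ≡ fromℕ c → x ∈ P
  recolour≡fromℕ⇒∈ {x} eq with x ∈? P
  ... | yes x∈P = x∈P
  ... | no  _   = contradiction (sym eq) fromℕ≢inject₁

  monochromatic-meeting⇒⊆ : ∀ {B x} → Monochromatic recolour B → x ∈ B → x ∈ P → B ⊆ P
  monochromatic-meeting⇒⊆ {x = x} mono x∈B x∈P {y} y∈B =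
    recolour≡fromℕ⇒∈ (trans (mono y x y∈B x∈B) (recolour-∈ x∈P))

  monochromatic-outside⇒monochromatic : ∀ {B} → (∀ {x} → x ∈ B → x ∉ P) →
                                         Monochromatic recolour B → Monochromatic f B
  monochromatic-outside⇒monochromatic avoids mono x y x∈B y∈B = inject₁-injective (begin
    inject₁ (f x)  ≡⟨ sym (recolour-∉ (avoids x∈B)) ⟩
    recolour x     ≡⟨ mono x y x∈B y∈B ⟩
    recolour y     ≡⟨ recolour-∉ (avoids y∈B) ⟩
    inject₁ (f y)  ∎)
    where open ≡-Reasoning

  large-monochromatic⇒∉ : ∀ {d B} → ∣ P ∣ ≤ d → d < ∣ B ∣ → Monochromatic recolour B →
                          ∀ {x} → x ∈ B → x ∉ P
  large-monochromatic⇒∉ ∣P∣≤d d<∣B∣ mono x∈B x∈P =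
    <⇒≱ d<∣B∣ (≤-trans (p⊆q⇒∣p∣≤∣q∣ (monochromatic-meeting⇒⊆ mono x∈B x∈P)) ∣P∣≤d)

  recolour-isWeakColouring : ∀ {d} (γ ℬ : List (Subset v)) → ∣ P ∣ ≤ d →
    All (λ B → d < ∣ B ∣) (γ ++ ℬ) → All (λ B → Nonempty (B ∩ P)) γ →
    IsWeakColouring c ℬ f → IsWeakColouring (suc c) (γ ++ ℬ) recolour
  recolour-isWeakColouring γ ℬ ∣P∣≤d large hits f-weak B B∈ mono with ∈-++⁻ γ B∈
  ... | inj₁ B∈γ = let x , x∈B∩P = All.lookup hits B∈γ
                       x∈B , x∈P = x∈p∩q⁻ B P x∈B∩P
                   in  large-monochromatic⇒∉ ∣P∣≤d (All.lookup large B∈) mono x∈B x∈P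
  ... | inj₂ B∈ℬ = f-weak B B∈ℬ
    (monochromatic-outside⇒monochromatic (large-monochromatic⇒∉ ∣P∣≤d (All.lookup large B∈) mono) mono)

weakColourable-++ : ∀ {v} d q {c} (β ℬ : List (Subset v)) → length β ≤ q * d →
  All (λ B → d < ∣ B ∣) β → All (λ B → d < ∣ B ∣) ℬ →
  WeakColourable ℬ c → WeakColourable (β ++ ℬ) (q + c)
weakColourable-++ d zero    []    ℬ _      _      _      colourable = colourable
weakColourable-++ d (suc q) {c} β ℬ ∣β∣≤[1+q]*d largeβ largeℬ colourable =
  let f , f-weak         = weakColourable-++ d q δ ℬ ∣δ∣≤q*d (All.drop⁺ d largeβ) largeℬ colourable
      P , ∣P∣≤∣γ∣ , hits = transversal γ (All.map nonempty (All.take⁺ d largeβ))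
  in  subst (λ ℬ″ → WeakColourable ℬ″ (suc q + c)) γ++δ++ℬ≡β++ℬ
        ( recolour P f
        , recolour-isWeakColouring P f γ (δ ++ ℬ) (≤-trans ∣P∣≤∣γ∣ ∣γ∣≤d) largeγδℬ hits f-weak)
  where
  γ δ : List (Subset _)
  γ = take d β
  δ = drop d β

  γ++δ++ℬ≡β++ℬ : γ ++ δ ++ ℬ ≡ β ++ ℬ
  γ++δ++ℬ≡β++ℬ = trans (sym (++-assoc γ δ ℬ)) (cong (_++ ℬ) (take++drop≡id d β))

  largeγδℬ : All (λ B → d < ∣ B ∣) (γ ++ δ ++ ℬ)
  largeγδℬ = All.++⁺ (All.take⁺ d largeβ) (All.++⁺ (All.drop⁺ d largeβ) largeℬ)

  nonempty : ∀ {B} → d < ∣ B ∣ → Nonempty B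
  nonempty {B} = 0<∣p∣⇒Nonempty B ∘ <-≤-trans z<s

  ∣γ∣≤d : length γ ≤ d
  ∣γ∣≤d = subst (_≤ d) (sym (length-take d β)) (m⊓n≤m d (length β))

  ∣δ∣≤q*d : length δ ≤ q * d
  ∣δ∣≤q*d = begin
    length δ         ≡⟨ length-drop d β ⟩
    length β ∸ d     ≤⟨ ∸-monoˡ-≤ d ∣β∣≤[1+q]*d ⟩
    d + q * d ∸ d    ≡⟨ m+n∸m≡n d (q * d) ⟩
    q * d            ∎
    where open ≤-Reasoning

weakColourable-⊆ : ∀ {v c} {ℬ₁ ℬ₂ : List (Subset v)} → (∀ {B} → B ∈ₗ ℬ₁ → B ∈ₗ ℬ₂) →
                   WeakColourable ℬ₂ c → WeakColourable ℬ₁ c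
weakColourable-⊆ ℬ₁⊆ℬ₂ (f , f-weak) = f , λ B B∈ℬ₁ → f-weak B (ℬ₁⊆ℬ₂ B∈ℬ₁)

chromaticNumber-least : ∀ {v χ c} {ℬ : List (Subset v)} →
                        IsChromaticNumber ℬ χ → WeakColourable ℬ c → χ ≤ c
chromaticNumber-least (_ , least) colourable = ≮⇒≥ (λ c<χ → least _ c<χ colourable)

packing-blockSize : ∀ {v k ℬ B} → IsPacking v k ℬ → B ∈ₗ ℬ → ∣ B ∣ ≡ k
packing-blockSize {k = k} (sizes , _) B∈ℬ =
  subst (λ B → ∣ B ∣ ≡ k) (sym (lookup-index B∈ℬ)) (sizes (index B∈ℬ))

m≤⌈m/[1+n]⌉*[1+n] : ∀ m n → m ≤ ⌈ m / suc n ⌉ * suc n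
m≤⌈m/[1+n]⌉*[1+n] m n = +-cancelʳ-≤ n m q*n (begin
  m + n                       ≡⟨ m≡m%n+[m/n]*n (m + n) (suc n) ⟩
  (m + n) % suc n + q*n       ≤⟨ +-monoˡ-≤ q*n (≤-pred (m%n<n (m + n) (suc n))) ⟩
  n + q*n                     ≡⟨ +-comm n q*n ⟩
  q*n + n                     ∎)
  where
  open ≤-Reasoning
  q*n : ℕ
  q*n = ⌈ m / suc n ⌉ * suc n

theorem3p13 : (v k t : ℕ) → 2 ≤ k → (ℬ β ℬ' : List (Subset v)) →
    IsPacking v k ℬ → ℬ ↭ β ++ ℬ' → length β ≡ t →
    (χD χD' : ℕ) → IsChromaticNumber ℬ χD → IsChromaticNumber ℬ' χD' →
    χD ≤ χD' + ⌈ t / (k ∸ 1) ⌉ × χD' ≤ χD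
theorem3p13 v (suc k-1@(suc _)) t (s≤s (s≤s z≤n)) ℬ β ℬ' packing ℬ↭β++ℬ' refl χD χD' χ-D χ-D' =
  lower , upper
  where
  β++ℬ'⊆ℬ : ∀ {B} → B ∈ₗ β ++ ℬ' → B ∈ₗ ℬ
  β++ℬ'⊆ℬ = ∈-resp-↭ (↭-sym ℬ↭β++ℬ')

  large : All (λ B → k-1 < ∣ B ∣) (β ++ ℬ')
  large = All.tabulate (≤-reflexive ∘ sym ∘ packing-blockSize packing ∘ β++ℬ'⊆ℬ)

  q : ℕ
  q = ⌈ length β / k-1 ⌉

  D-colourable : WeakColourable ℬ (q + χD')
  D-colourable = weakColourable-⊆ (∈-resp-↭ ℬ↭β++ℬ')
    (weakColourable-++ k-1 q β ℬ' (m≤⌈m/[1+n]⌉*[1+n] (length β) _)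
      (All.++⁻ˡ β large) (All.++⁻ʳ β large) (proj₁ χ-D'))

  lower : χD ≤ χD' + q
  lower = subst (χD ≤_) (+-comm q χD') (chromaticNumber-least χ-D D-colourable)

  upper : χD' ≤ χD
  upper = chromaticNumber-least χ-D' (weakColourable-⊆ (β++ℬ'⊆ℬ ∘ ∈-++⁺ʳ β) (proj₁ χ-D))
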